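{- If $L=(X,\leq)$ is a finite distributive lattice, then for every meet-irreducible $m$ of $L$ we have $|\mathfrak{U}_m|=1$.
   Context: $x\prec y$ means $y$ covers $x$; $M$ is the set of meet-irreducibles (elements with exactly one upper cover), $M_x=\{m\in M:x\le m\}$. A finite distributive lattice is upper locally distributive, so for each cover $x\prec y$ the set $M_x\setminus M_y$ has exactly one element, denoted $\mathfrak{m}(x,y)$. For $m\in M$, $\mathfrak{U}_m$ is the set of minimal elements of $\{x\in X:\exists y\in X,\ x\prec y,\ \mathfrak{m}(x,y)=m\}$. -}

module Defs where

open import Level using (Level; _⊔_)
open import Data.Nat using (ℕ)
open import Data.Fin using (Fin)
open import Data.Product using (Σ; ∃; _×_)
open import Data.Sum using (_⊎_)
open import Relation.Nullary using (¬_)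
open import Function.Bundles using (Inverse)
import Relation.Binary.PropositionalEquality as ≡
open import Relation.Binary.Lattice.Bundles using (DistributiveLattice)

module _ {c ℓ₁ ℓ₂ : Level} (L : DistributiveLattice c ℓ₁ ℓ₂) where
  open DistributiveLattice L

  private X = Carrier

  IsFinite : Set (c ⊔ ℓ₁)
  IsFinite = Σ ℕ λ n → Inverse setoid (≡.setoid (Fin n))

  _<_ : X → X → Set (ℓ₁ ⊔ ℓ₂)
  x < y = x ≤ y × ¬ (x ≈ y)

  _≺_ : X → X → Set (c ⊔ ℓ₁ ⊔ ℓ₂)
  x ≺ y = x < y × (∀ z → x ≤ z → z ≤ y → (z ≈ x) ⊎ (z ≈ y))

  MeetIrreducible : X → Set (c ⊔ ℓ₁ ⊔ ℓ₂)
  MeetIrreducible m = ∃ λ y → m ≺ y × (∀ z → m ≺ z → z ≈ y)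

  -- 𝔪(x,y) = m for a cover x ≺ y : m is the (unique) element of
  -- M_x ∖ M_y, i.e. m ∈ M, x ≤ m and not y ≤ m.
  Label : X → X → X → Set (c ⊔ ℓ₁ ⊔ ℓ₂)
  Label x y m = x ≺ y × MeetIrreducible m × x ≤ m × ¬ (y ≤ m)

  LabelSet : X → X → Set (c ⊔ ℓ₁ ⊔ ℓ₂)
  LabelSet m x = ∃ λ y → Label x y m

  𝔘 : X → X → Set (c ⊔ ℓ₁ ⊔ ℓ₂)
  𝔘 m x = LabelSet m x × (∀ z → LabelSet m z → z ≤ x → z ≈ x)

-- Let m⁺ be the unique upper cover of m.  Finiteness gives
-- decidable ≈ and ≤ and minimal elements below any witness of a decidable
-- predicate; in particular every w > m lies above some cover of m, hence
-- above m⁺.  Distributivity then makes m meet-prime: a, b ≰ m implies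
-- a ∧ b ≰ m (both m ∨ a and m ∨ b lie above m⁺, and so does their meet
-- m ∨ (a ∧ b)).  Consequently the set {z : z ≰ m} has a least element j,
-- and u = j ∧ m is covered by j with label m.  Conversely, if x ≺ y has
-- label m then y ∧ m lies between x and y and differs from y, so
-- x ≈ y ∧ m ≥ j ∧ m = u.  Thus u is the least element of the label set,
-- hence its unique minimal element.
module Submission where

open import Defs
open import Level using (Level; _⊔_)
open import Data.Nat using (ℕ)
open import Data.Product using (∃; _×_; _,_; proj₁; proj₂)
open import Data.Sum using (_⊎_; inj₁; inj₂)
open import Data.Empty using (⊥-elim)
open import Data.Fin using (Fin)
open import Data.Fin.Properties using (_≟_)
open import Data.List using (List; []; _∷_; allFin)
open import Data.List.Membership.Propositional using (_∈_)
open import Data.List.Membership.Propositional.Properties using (∈-allFin)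
open import Data.List.Relation.Unary.Any using (here; there)
open import Relation.Nullary using (¬_; Dec; yes; no; ¬?)
open import Relation.Nullary.Decidable using (_×-dec_)
open import Relation.Binary.Definitions using (Decidable)
open import Relation.Binary.Bundles using (Poset)
open import Relation.Binary.Lattice.Bundles using (DistributiveLattice)
open import Function.Bundles using (Inverse)
import Relation.Binary.PropositionalEquality as ≡
import Relation.Binary.Lattice.Properties.DistributiveLattice as DistributiveLatticeProperties

module MinimalElements {c ℓ₁ ℓ₂ : Level} (P : Poset c ℓ₁ ℓ₂) where
  open Poset P

  Minimal : ∀ {p} → (Carrier → Set p) → Carrier → Set (c ⊔ p ⊔ ℓ₁ ⊔ ℓ₂)
  Minimal Q x = ∀ z → Q z → z ≤ x → z ≈ x

  least⇒uniqueMinimal : ∀ {p} {Q : Carrier → Set p} {u} → Q u → (∀ x → Q x → u ≤ x) →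
    ∃ λ u → (Q u × Minimal Q u) × (∀ v → Q v × Minimal Q v → v ≈ u)
  least⇒uniqueMinimal {u = u} qu least =
    u , (qu , λ z qz z≤u → antisym z≤u (least z qz)) ,
    λ v (qv , min-v) → Eq.sym (min-v u qu (least v qv))

module FinitePoset {c ℓ₁ ℓ₂ : Level} (P : Poset c ℓ₁ ℓ₂) {n : ℕ}
  (enum : Inverse (Poset.Eq.setoid P) (≡.setoid (Fin n)))
  (_≤?_ : Decidable (Poset._≤_ P)) where

  open Poset P
  open Inverse enum using (to; from; strictlyInverseʳ)

  open MinimalElements P using (Minimal)

  module _ {p} {Q : Carrier → Set p} (Q? : ∀ x → Dec (Q x))
           (Q-resp : ∀ {x y} → x ≈ y → Q x → Q y) where

    private
      descendTo : Fin n → Carrier → Carrier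
      descendTo i x with Q? (from i) ×-dec (from i ≤? x)
      ... | yes _ = from i
      ... | no  _ = x

      descend : List (Fin n) → Carrier → Carrier
      descend []       x = x
      descend (i ∷ is) x = descend is (descendTo i x)

      descendTo-≤ : ∀ i x → descendTo i x ≤ x
      descendTo-≤ i x with Q? (from i) ×-dec (from i ≤? x)
      ... | yes (_ , i≤x) = i≤x
      ... | no  _         = refl

      descendTo-Q : ∀ i x → Q x → Q (descendTo i x)
      descendTo-Q i x qx with Q? (from i) ×-dec (from i ≤? x)
      ... | yes (qi , _) = qi
      ... | no  _        = qx

      descend-≤ : ∀ is x → descend is x ≤ x
      descend-≤ []       x = refl
      descend-≤ (i ∷ is) x = trans (descend-≤ is (descendTo i x)) (descendTo-≤ i x)

      descend-Q : ∀ is x → Q x → Q (descend is x)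
      descend-Q []       x qx = qx
      descend-Q (i ∷ is) x qx = descend-Q is (descendTo i x) (descendTo-Q i x qx)

      -- Invariant: no scanned Q-element lies strictly below the result.
      -- For the head i: if the step fired, the result is below from i;
      -- if not, from i ≤ result ≤ x would have made it fire.
      descend-minimal : ∀ is x i → i ∈ is → Q (from i) →
                        from i ≤ descend is x → from i ≈ descend is x
      descend-minimal (i ∷ is) x i (here ≡.refl) qi i≤r
        with Q? (from i) ×-dec (from i ≤? x)
      ... | yes _  = antisym i≤r (descend-≤ is (from i))
      ... | no  ¬q = ⊥-elim (¬q (qi , trans i≤r (descend-≤ is x)))
      descend-minimal (j ∷ is) x i (there i∈is) qi i≤r =
        descend-minimal is (descendTo j x) i i∈is qi i≤r

    minimal-below : ∀ w → Q w → ∃ λ x → Q x × x ≤ w × Minimal Q x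
    minimal-below w qw =
      r , descend-Q (allFin n) w qw , descend-≤ (allFin n) w , minimal
      where
      r : Carrier
      r = descend (allFin n) w

      minimal : Minimal Q r
      minimal z qz z≤r = Eq.trans (Eq.sym z≈) (descend-minimal (allFin n) w (to z)
        (∈-allFin (to z)) (Q-resp (Eq.sym z≈) qz) (trans (reflexive z≈) z≤r))
        where
        z≈ : from (to z) ≈ z
        z≈ = strictlyInverseʳ z

module FiniteDistributiveLattice {c ℓ₁ ℓ₂ : Level}
  (L : DistributiveLattice c ℓ₁ ℓ₂) (fin : IsFinite L) where

  open DistributiveLattice L
  open DistributiveLatticeProperties L using (∨-distribˡ-∧)
  open Inverse (proj₂ fin) using (to; to-cong; from-cong; strictlyInverseʳ)

  _≈?_ : Decidable _≈_
  x ≈? y with to x ≟ to y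
  ... | yes e = yes (Eq.trans (Eq.sym (strictlyInverseʳ x))
                    (Eq.trans (from-cong e) (strictlyInverseʳ y)))
  ... | no ¬e = no (λ x≈y → ¬e (to-cong x≈y))

  _≤?_ : Decidable _≤_
  x ≤? y with (x ∧ y) ≈? x
  ... | yes e = yes (trans (reflexive (Eq.sym e)) (x∧y≤y x y))
  ... | no ¬e = no (λ x≤y → ¬e (antisym (x∧y≤x x y) (∧-greatest refl x≤y)))

  open MinimalElements poset using (Minimal)
  open FinitePoset poset (proj₂ fin) _≤?_ using (minimal-below)

  -- Every strict upper bound w of x lies above some upper cover of x:
  -- take a minimal element of the interval (x, w].
  cover-below : ∀ {x w} → _<_ L x w → ∃ λ y → _≺_ L x y × y ≤ w
  cover-below {x} {w} x<w = y , (x<y , covers) , y≤w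
    where
    Q : Carrier → Set (ℓ₁ ⊔ ℓ₂)
    Q v = _<_ L x v × v ≤ w

    Q? : ∀ v → Dec (Q v)
    Q? v = ((x ≤? v) ×-dec ¬? (x ≈? v)) ×-dec (v ≤? w)

    Q-resp : ∀ {a b} → a ≈ b → Q a → Q b
    Q-resp a≈b ((x≤a , x≉a) , a≤w) =
      (trans x≤a (reflexive a≈b) , λ x≈b → x≉a (Eq.trans x≈b (Eq.sym a≈b))) ,
      trans (reflexive (Eq.sym a≈b)) a≤w

    found : ∃ λ y → Q y × y ≤ w × Minimal Q y
    found = minimal-below Q? Q-resp w (x<w , refl)

    y : Carrier
    y = proj₁ found

    x<y : _<_ L x y
    x<y = proj₁ (proj₁ (proj₂ found))

    y≤w : y ≤ w
    y≤w = proj₁ (proj₂ (proj₂ found))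

    minimal : Minimal Q y
    minimal = proj₂ (proj₂ (proj₂ found))

    covers : ∀ z → x ≤ z → z ≤ y → z ≈ x ⊎ z ≈ y
    covers z x≤z z≤y with z ≈? x
    ... | yes z≈x = inj₁ z≈x
    ... | no  z≉x = inj₂ (minimal z ((x≤z , λ x≈z → z≉x (Eq.sym x≈z)) ,
                                      trans z≤y y≤w) z≤y)

  module MeetIrreducibleElement (m : Carrier) (irr : MeetIrreducible L m) where

    m⁺ : Carrier
    m⁺ = proj₁ irr

    m≺m⁺ : _≺_ L m m⁺
    m≺m⁺ = proj₁ (proj₂ irr)

    m⁺≰m : ¬ m⁺ ≤ m
    m⁺≰m m⁺≤m = proj₂ (proj₁ m≺m⁺) (antisym (proj₁ (proj₁ m≺m⁺)) m⁺≤m)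

    m⁺-least-above : ∀ {w} → _<_ L m w → m⁺ ≤ w
    m⁺-least-above m<w with cover-below m<w
    ... | y , m≺y , y≤w = trans (reflexive (Eq.sym (proj₂ (proj₂ irr) y m≺y))) y≤w

    m⁺≤m∨ : ∀ {a} → ¬ a ≤ m → m⁺ ≤ m ∨ a
    m⁺≤m∨ {a} a≰m = m⁺-least-above (x≤x∨y m a ,
      λ m≈m∨a → a≰m (trans (y≤x∨y m a) (reflexive (Eq.sym m≈m∨a))))

    -- m is meet-prime: m⁺ ≤ (m ∨ a) ∧ (m ∨ b) ≈ m ∨ (a ∧ b).
    meet-prime : ∀ {a b} → ¬ a ≤ m → ¬ b ≤ m → ¬ a ∧ b ≤ m
    meet-prime {a} {b} a≰m b≰m a∧b≤m = m⁺≰m (trans (∧-greatest (m⁺≤m∨ a≰m) (m⁺≤m∨ b≰m))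
      (trans (reflexive (Eq.sym (∨-distribˡ-∧ m a b))) (∨-least refl a∧b≤m)))

    -- The set {z : z ≰ m} has a least element j: a minimal element j of it
    -- satisfies j ∧ z ≈ j for every z ≰ m, because j ∧ z ≰ m by primality.
    least-outside : ∃ λ j → ¬ j ≤ m × (∀ z → ¬ z ≤ m → j ≤ z)
    least-outside = j , j≰m , j-least
      where
      Q-resp : ∀ {a b} → a ≈ b → ¬ a ≤ m → ¬ b ≤ m
      Q-resp a≈b a≰m b≤m = a≰m (trans (reflexive a≈b) b≤m)

      found : ∃ λ j → ¬ j ≤ m × j ≤ m⁺ × Minimal (λ v → ¬ v ≤ m) j
      found = minimal-below (λ v → ¬? (v ≤? m)) Q-resp m⁺ m⁺≰m

      j : Carrier
      j = proj₁ found

      j≰m : ¬ j ≤ m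
      j≰m = proj₁ (proj₂ found)

      j-least : ∀ z → ¬ z ≤ m → j ≤ z
      j-least z z≰m = trans (reflexive (Eq.sym j∧z≈j)) (x∧y≤y j z)
        where
        j∧z≈j : j ∧ z ≈ j
        j∧z≈j = proj₂ (proj₂ (proj₂ found)) (j ∧ z) (meet-prime j≰m z≰m) (x∧y≤x j z)

    j : Carrier
    j = proj₁ least-outside

    j≰m : ¬ j ≤ m
    j≰m = proj₁ (proj₂ least-outside)

    j-least : ∀ z → ¬ z ≤ m → j ≤ z
    j-least = proj₂ (proj₂ least-outside)

    u : Carrier
    u = j ∧ m

    -- j covers u = j ∧ m: anything in between is either ≤ m (so ≈ u)
    -- or ≰ m (so ≥ j).
    u-labelled : LabelSet L m u
    u-labelled = j , ((x∧y≤x j m , u≉j) , covers) , irr , x∧y≤y j m , j≰m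
      where
      u≉j : ¬ u ≈ j
      u≉j u≈j = j≰m (trans (reflexive (Eq.sym u≈j)) (x∧y≤y j m))

      covers : ∀ z → u ≤ z → z ≤ j → z ≈ u ⊎ z ≈ j
      covers z u≤z z≤j with z ≤? m
      ... | yes z≤m = inj₁ (antisym (∧-greatest z≤j z≤m) u≤z)
      ... | no  z≰m = inj₂ (antisym z≤j (j-least z z≰m))

    -- If x ≺ y has label m then x ≈ y ∧ m (it lies in [x, y] and is not y),
    -- and j ≤ y gives u = j ∧ m ≤ y ∧ m.
    u-least : ∀ x → LabelSet L m x → u ≤ x
    u-least x (y , ((x<y , covers) , _ , x≤m , y≰m))
      with covers (y ∧ m) (∧-greatest (proj₁ x<y) x≤m) (x∧y≤x y m)
    ... | inj₁ y∧m≈x = trans (∧-greatest (trans (x∧y≤x j m) (j-least y y≰m)) (x∧y≤y j m))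
                             (reflexive y∧m≈x)
    ... | inj₂ y∧m≈y = ⊥-elim (y≰m (trans (reflexive (Eq.sym y∧m≈y)) (x∧y≤y y m)))

mainTheorem7 : ∀ {c ℓ₁ ℓ₂} (L : DistributiveLattice c ℓ₁ ℓ₂) → IsFinite L →
    ∀ m → MeetIrreducible L m →
    ∃ λ u → 𝔘 L m u × (∀ v → 𝔘 L m v → DistributiveLattice._≈_ L v u)
mainTheorem7 L fin m irr =
  least⇒uniqueMinimal u-labelled u-least
  where
  open FiniteDistributiveLattice L fin
  open MinimalElements (DistributiveLattice.poset L) using (least⇒uniqueMinimal)
  open MeetIrreducibleElement m irr
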